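{- If $(k-1)$-dimensional \textsc{Tarski} can be solved using $q$ queries, then $k$-dimensional \textsc{Tarski} can be solved using $(q+2)\cdot(\log n + 2)$ queries.
   Context: For positive integers $n_1,\dots,n_k$, the lattice $L = L(n_1,\dots,n_k)$ is the set of all $x \in \mathbb{N}^k$ with $1 \le x_i \le n_i$, ordered by $x \preceq y$ iff $x_i \le y_i$ for all $i$; its width is $n = \max_i n_i$. The $k$-dimensional \textsc{Tarski} problem: given query access to $f : L \to L$ on a $k$-dimensional lattice (a query is one evaluation of $f$), find either (T1) $x \in L$ with $f(x)=x$, or (T2) $x, y \in L$ with $x \preceq y$ and $f(x) \not\preceq f(y)$. -}

module Defs where

open import Data.Nat using (ℕ; zero; suc; _+_; _*_; _∸_; _^_) renaming (_≤_ to _≤ℕ_)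
open import Data.Fin using (Fin) renaming (_≤_ to _≤F_)
open import Data.Product using (Σ; _×_; _,_)
open import Data.Sum using (_⊎_; inj₁; inj₂)
open import Relation.Nullary using (¬_)
open import Relation.Binary.PropositionalEquality using (_≡_)

-- The lattice L(n_1,...,n_k): a point x has coordinates x_i ∈ {1..n_i},
-- represented 0-indexed as x i : Fin (ns i) (the shift by one is order-preserving).
Point : (k : ℕ) → (Fin k → ℕ) → Set
Point k ns = (i : Fin k) → Fin (ns i)

_⪯_ : {k : ℕ} {ns : Fin k → ℕ} → Point k ns → Point k ns → Set
_⪯_ {k} x y = (i : Fin k) → x i ≤F y i

_≐_ : {k : ℕ} {ns : Fin k → ℕ} → Point k ns → Point k ns → Set
_≐_ {k} x y = (i : Fin k) → x i ≡ y i

Answer : (k : ℕ) → (Fin k → ℕ) → Set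
Answer k ns = Point k ns ⊎ (Point k ns × Point k ns)

Valid : {k : ℕ} {ns : Fin k → ℕ} → (Point k ns → Point k ns) → Answer k ns → Set
Valid f (inj₁ x) = f x ≐ x
Valid f (inj₂ (x , y)) = (x ⪯ y) × ¬ (f x ⪯ f y)

-- Deterministic adaptive query algorithms (decision trees): either output
-- an answer, or query f at a point and continue depending on the value f(x).
data Alg (k : ℕ) (ns : Fin k → ℕ) : Set where
  output : Answer k ns → Alg k ns
  query  : Point k ns → (Point k ns → Alg k ns) → Alg k ns

run : {k : ℕ} {ns : Fin k → ℕ} → Alg k ns → (Point k ns → Point k ns) → Answer k ns
run (output a) f = a
run (query x next) f = run (next (f x)) f

cost : {k : ℕ} {ns : Fin k → ℕ} → Alg k ns → (Point k ns → Point k ns) → ℕ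
cost (output a) f = zero
cost (query x next) f = suc (cost (next (f x)) f)

SolvableWith : (k : ℕ) → (Fin k → ℕ) → ℕ → Set
SolvableWith k ns q =
  Σ (Alg k ns) λ A → (f : Point k ns → Point k ns) → (cost A f ≤ℕ q) × Valid f (run A f)

SizesBounded : (k : ℕ) → (Fin k → ℕ) → ℕ → Set
SizesBounded k ns n = (i : Fin k) → (1 ≤ℕ ns i) × (ns i ≤ℕ n)

-- For n ≥ 1, the real inequality  c ≤ (q+2)·(log₂ n + 2)  is equivalent to
-- 2^(c - 2(q+2)) ≤ n^(q+2)  (with truncated subtraction; if c ≤ 2(q+2) both sides hold).
WithinBound : ℕ → ℕ → ℕ → Set
WithinBound n q c = 2 ^ (c ∸ 2 * (q + 2)) ≤ℕ n ^ (q + 2)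

-- Binary search on the first coordinate, keeping two points lo ⪯ hi with
-- lo ⪯ f lo and f hi ⪯ hi.  If f is monotone, every fixed point between them
-- has its first coordinate in a window [a, a + s) with a ≤ f(lo)₀ and
-- f(hi)₀ < a + s.  A round fixes the first coordinate at the middle m of the
-- window and runs the (k-1)-dimensional algorithm on the slice x ↦ f(m, x),
-- clamped into the box [lo, hi] so that it maps the slice to itself.  A
-- violation for the slice is a violation for f; a fixed point x yields the
-- query p = (m, x), and either f p leaves the box (a violation with lo or hi),
-- or f p agrees with p off the first coordinate and p is a fixed point or
-- replaces lo or hi, halving the window.  After ⌊log₂ n⌋ + 1 rounds of q + 1
-- queries the window is empty, so f lo ⋠ f hi.

module Submission where

open import Defs
open import Data.Nat using (ℕ; suc)
open import Data.Fin using (Fin)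
open import Data.Product using (Σ; _×_)

open import Data.Nat
  using (zero; _+_; _*_; _∸_; _^_; _⊔_; _⊓_; _≤_; _<_; z≤n; s≤s; s≤s⁻¹; z<s; s<s; _<?_;
         ⌊_/2⌋; ⌈_/2⌉)
open import Data.Nat.Properties
open import Data.Fin using (zero; suc; toℕ; fromℕ; fromℕ<) renaming (_≤_ to _≤ᶠ_)
open import Data.Fin.Properties using (toℕ-fromℕ; toℕ-fromℕ<; ≤fromℕ; toℕ<n; toℕ-injective; all?)
  renaming (_≤?_ to _≤ᶠ?_)
open import Data.Product using (_,_; proj₁; proj₂; map₁)
open import Data.Sum using (inj₁; inj₂)
open import Function using (_∘_)
open import Relation.Nullary using (¬_; Dec; yes; no; contradiction)
open import Relation.Binary using (Tri; tri<; tri≈; tri>)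
open import Relation.Binary.PropositionalEquality
  using (_≡_; refl; sym; trans; cong; subst; module ≡-Reasoning)

n<2*m⇒⌊n/2⌋<m : ∀ n {m} → n < 2 * m → ⌊ n /2⌋ < m
n<2*m⇒⌊n/2⌋<m n {zero} ()
n<2*m⇒⌊n/2⌋<m zero {suc m} _ = z<s
n<2*m⇒⌊n/2⌋<m (suc zero) {suc m} _ = z<s
n<2*m⇒⌊n/2⌋<m (suc (suc n)) {suc m} (s≤s n+2≤2m+1) =
  s<s (n<2*m⇒⌊n/2⌋<m n (s≤s⁻¹ n+2≤2m+2))
  where
    n+2≤2m+2 : suc (suc n) ≤ suc (2 * m)
    n+2≤2m+2 = subst (suc (suc n) ≤_) (+-suc m (m + 0)) n+2≤2m+1

floor-log₂ : ∀ n → 1 ≤ n → Σ ℕ λ e → 2 ^ e ≤ n × n < 2 ^ suc e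
floor-log₂ (suc zero) _ = 0 , ≤-refl , s<s z<s
floor-log₂ (suc (suc m)) _ with floor-log₂ (suc m) (s≤s z≤n)
... | e , lower , upper with suc (suc m) <? 2 ^ suc e
...   | yes m+2<2^e+1 = e , m≤n⇒m≤1+n lower , m+2<2^e+1
...   | no m+2≮2^e+1 =
  suc e , ≮⇒≥ m+2≮2^e+1 , ≤-<-trans upper (^-monoʳ-< 2 (s<s (s<s z≤n)) (n<1+n (suc e)))

withinBound : ∀ {n} q e → 2 ^ e ≤ n → WithinBound n q (suc e * suc q)
withinBound {n} q e 2^e≤n = begin
  2 ^ (suc e * suc q ∸ 2 * (q + 2)) ≤⟨ ^-monoʳ-≤ 2 exponent≤ ⟩
  2 ^ (e * (q + 2))                 ≡⟨ ^-*-assoc 2 e (q + 2) ⟨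
  (2 ^ e) ^ (q + 2)                 ≤⟨ ^-monoˡ-≤ (q + 2) 2^e≤n ⟩
  n ^ (q + 2)                       ∎
  where
    open ≤-Reasoning
    q+1≤q+2 : suc q ≤ q + 2
    q+1≤q+2 = subst (suc q ≤_) (+-comm 2 q) (n≤1+n (suc q))
    exponent≤ : suc e * suc q ∸ 2 * (q + 2) ≤ e * (q + 2)
    exponent≤ = m≤n+o⇒m∸n≤o (suc e * suc q) (2 * (q + 2))
      (+-mono-≤ (≤-trans q+1≤q+2 (m≤m+n (q + 2) _)) (*-monoʳ-≤ e q+1≤q+2))

module _ {N : ℕ} where

  clamp : Fin N → Fin N → ℕ → Fin N
  clamp l h x = fromℕ< (≤-<-trans (m⊓n≤n (toℕ l ⊔ x) (toℕ h)) (toℕ<n h))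

  toℕ-clamp : ∀ l h x → toℕ (clamp l h x) ≡ (toℕ l ⊔ x) ⊓ toℕ h
  toℕ-clamp l h x = toℕ-fromℕ< _

  clamp-≥ : ∀ l h x → toℕ l ≤ toℕ h → toℕ l ≤ toℕ (clamp l h x)
  clamp-≥ l h x l≤h =
    subst (toℕ l ≤_) (sym (toℕ-clamp l h x)) (⊓-glb (m≤m⊔n (toℕ l) x) l≤h)

  clamp-≤ : ∀ l h x → toℕ (clamp l h x) ≤ toℕ h
  clamp-≤ l h x = subst (_≤ toℕ h) (sym (toℕ-clamp l h x)) (m⊓n≤n (toℕ l ⊔ x) (toℕ h))

  clamp-mono : ∀ l h {x y} → x ≤ y → toℕ (clamp l h x) ≤ toℕ (clamp l h y)
  clamp-mono l h {x} {y} x≤y = begin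
    toℕ (clamp l h x)       ≡⟨ toℕ-clamp l h x ⟩
    (toℕ l ⊔ x) ⊓ toℕ h     ≤⟨ ⊓-monoˡ-≤ (toℕ h) (⊔-monoʳ-≤ (toℕ l) x≤y) ⟩
    (toℕ l ⊔ y) ⊓ toℕ h     ≡⟨ toℕ-clamp l h y ⟨
    toℕ (clamp l h y)       ∎
    where open ≤-Reasoning

  toℕ-clamp-id : ∀ l h {x} → toℕ l ≤ x → x ≤ toℕ h → toℕ (clamp l h x) ≡ x
  toℕ-clamp-id l h {x} l≤x x≤h = begin
    toℕ (clamp l h x)       ≡⟨ toℕ-clamp l h x ⟩
    (toℕ l ⊔ x) ⊓ toℕ h     ≡⟨ cong (_⊓ toℕ h) (m≤n⇒m⊔n≡n l≤x) ⟩
    x ⊓ toℕ h               ≡⟨ m≤n⇒m⊓n≡m x≤h ⟩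
    x                       ∎
    where open ≡-Reasoning

least greatest : ∀ {n} → 1 ≤ n → Fin n
least {suc _} _ = zero
greatest {suc n} _ = fromℕ n

least-≤ : ∀ {n} (1≤n : 1 ≤ n) (x : Fin n) → toℕ (least 1≤n) ≤ toℕ x
least-≤ {suc _} _ _ = z≤n

≤-greatest : ∀ {n} (1≤n : 1 ≤ n) (x : Fin n) → toℕ x ≤ toℕ (greatest 1≤n)
≤-greatest {suc _} _ x = ≤fromℕ x

toℕ-least : ∀ {n} (1≤n : 1 ≤ n) → toℕ (least 1≤n) ≡ 0
toℕ-least {suc _} _ = refl

suc-toℕ-greatest : ∀ {n} (1≤n : 1 ≤ n) → suc (toℕ (greatest 1≤n)) ≡ n
suc-toℕ-greatest {suc n} _ = cong suc (toℕ-fromℕ n)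

SolvesWithin : ∀ {k ns} → Alg k ns → (Point k ns → Point k ns) → ℕ → Set
SolvesWithin A f q = cost A f ≤ q × Valid f (run A f)

simulate : ∀ {k k′ ns ns′} → (Point k′ ns′ → Point k ns) → (Point k ns → Point k′ ns′) →
           Alg k′ ns′ → (Answer k′ ns′ → Alg k ns) → Alg k ns
simulate ι π (output a)     κ = κ a
simulate ι π (query x next) κ = query (ι x) (λ y → simulate ι π (next (π y)) κ)

module _ {k k′ ns ns′} (ι : Point k′ ns′ → Point k ns) (π : Point k ns → Point k′ ns′)
         (f : Point k ns → Point k ns) where

  run-simulate : ∀ B κ → run (simulate ι π B κ) f ≡ run (κ (run B (π ∘ f ∘ ι))) f
  run-simulate (output a)     κ = refl
  run-simulate (query x next) κ = run-simulate (next _) κ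

  cost-simulate : ∀ B κ →
    cost (simulate ι π B κ) f ≡ cost B (π ∘ f ∘ ι) + cost (κ (run B (π ∘ f ∘ ι))) f
  cost-simulate (output a)     κ = refl
  cost-simulate (query x next) κ = cong suc (cost-simulate (next _) κ)

module _ {k : ℕ} {ns : Fin k → ℕ} where

  _⪯?_ : (x y : Point k ns) → Dec (x ⪯ y)
  x ⪯? y = all? (λ i → x i ≤ᶠ? y i)

  lower-violation : ∀ (f : Point k ns → Point k ns) {lo p} →
    lo ⪯ f lo → lo ⪯ p → ¬ lo ⪯ f p → Valid f (inj₂ (lo , p))
  lower-violation f lo⪯flo lo⪯p lo⋠fp =
    lo⪯p , λ flo⪯fp → lo⋠fp (λ i → ≤-trans (lo⪯flo i) (flo⪯fp i))

  upper-violation : ∀ (f : Point k ns → Point k ns) {p hi} →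
    f hi ⪯ hi → p ⪯ hi → ¬ f p ⪯ hi → Valid f (inj₂ (p , hi))
  upper-violation f fhi⪯hi p⪯hi fp⋠hi =
    p⪯hi , λ fp⪯fhi → fp⋠hi (λ i → ≤-trans (fp⪯fhi i) (fhi⪯hi i))

  bottom top : (∀ i → 1 ≤ ns i) → Point k ns
  bottom pos i = least (pos i)
  top    pos i = greatest (pos i)

  clampPoint : Point k ns → Point k ns → Point k ns → Point k ns
  clampPoint lo hi y i = clamp (lo i) (hi i) (toℕ (y i))

  module _ (lo hi : Point k ns) where

    clampPoint-≥ : lo ⪯ hi → ∀ y → lo ⪯ clampPoint lo hi y
    clampPoint-≥ lo⪯hi y i = clamp-≥ (lo i) (hi i) _ (lo⪯hi i)

    clampPoint-≤ : ∀ y → clampPoint lo hi y ⪯ hi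
    clampPoint-≤ y i = clamp-≤ (lo i) (hi i) _

    clampPoint-mono : ∀ {x y} → x ⪯ y → clampPoint lo hi x ⪯ clampPoint lo hi y
    clampPoint-mono x⪯y i = clamp-mono (lo i) (hi i) (x⪯y i)

    clampPoint-id : ∀ {y} → lo ⪯ y → y ⪯ hi → clampPoint lo hi y ≐ y
    clampPoint-id lo⪯y y⪯hi i = toℕ-injective (toℕ-clamp-id (lo i) (hi i) (lo⪯y i) (y⪯hi i))

module _ {k : ℕ} {ns : Fin (suc k) → ℕ} where

  infixr 25 _∷_
  _∷_ : Fin (ns zero) → Point k (ns ∘ suc) → Point (suc k) ns
  (m ∷ x) zero    = m
  (m ∷ x) (suc i) = x i

  tail : Point (suc k) ns → Point k (ns ∘ suc)
  tail x = x ∘ suc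

  slice : (Point (suc k) ns → Point (suc k) ns) → (lo hi : Point (suc k) ns) → Fin (ns zero) →
          Point k (ns ∘ suc) → Point k (ns ∘ suc)
  slice f lo hi m = tail ∘ clampPoint lo hi ∘ f ∘ (m ∷_)

  module _ (f : Point (suc k) ns → Point (suc k) ns) (lo hi : Point (suc k) ns) (m : Fin (ns zero))
    where

    slice-violation : ∀ {x y} → Valid (slice f lo hi m) (inj₂ (x , y)) →
                      Valid f (inj₂ (m ∷ x , m ∷ y))
    slice-violation {x} {y} (x⪯y , gx⋠gy) =
      m∷x⪯m∷y , λ fx⪯fy → gx⋠gy (clampPoint-mono lo hi fx⪯fy ∘ suc)
      where
        m∷x⪯m∷y : m ∷ x ⪯ m ∷ y
        m∷x⪯m∷y zero    = ≤-refl
        m∷x⪯m∷y (suc i) = x⪯y i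

    module _ {x} (fixed : Valid (slice f lo hi m) (inj₁ x)) where

      slice-fixed-point-≥ : lo ⪯ hi → toℕ (lo zero) ≤ toℕ m → lo ⪯ m ∷ x
      slice-fixed-point-≥ lo⪯hi lo≤m zero    = lo≤m
      slice-fixed-point-≥ lo⪯hi lo≤m (suc i) =
        subst (lo (suc i) ≤ᶠ_) (fixed i) (clampPoint-≥ lo hi lo⪯hi (f (m ∷ x)) (suc i))

      slice-fixed-point-≤ : toℕ m ≤ toℕ (hi zero) → m ∷ x ⪯ hi
      slice-fixed-point-≤ m≤hi zero    = m≤hi
      slice-fixed-point-≤ m≤hi (suc i) =
        subst (_≤ᶠ hi (suc i)) (fixed i) (clampPoint-≤ lo hi (f (m ∷ x)) (suc i))

      slice-fixed-point-tail : lo ⪯ f (m ∷ x) → f (m ∷ x) ⪯ hi → tail (f (m ∷ x)) ≐ x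
      slice-fixed-point-tail lo⪯fp fp⪯hi i =
        trans (sym (clampPoint-id lo hi lo⪯fp fp⪯hi (suc i))) (fixed i)

record Bracket {k} {ns : Fin (suc k) → ℕ} (f : Point (suc k) ns → Point (suc k) ns)
               (rounds a s : ℕ) (lo hi : Point (suc k) ns) : Set where
  field
    lo⪯hi      : lo ⪯ hi
    lo⪯f-lo    : lo ⪯ f lo
    f-hi⪯hi    : f hi ⪯ hi
    lo₀≤a      : toℕ (lo zero) ≤ a
    a≤f-lo₀    : a ≤ toℕ (f lo zero)
    a+s≤1+hi₀  : a + s ≤ suc (toℕ (hi zero))
    f-hi₀<a+s  : toℕ (f hi zero) < a + s
    s<2^rounds : s < 2 ^ rounds

midpoint : ∀ {k} {ns : Fin (suc k) → ℕ} → ℕ → ℕ → (lo hi : Point (suc k) ns) → Fin (ns zero)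
midpoint a t lo hi = clamp (lo zero) (hi zero) (a + ⌈ t /2⌉)

module _ {k} {ns : Fin (suc k) → ℕ} {f : Point (suc k) ns → Point (suc k) ns} where
  open Bracket

  empty-bracket-violation : ∀ {F a lo hi} → Bracket f F a 0 lo hi → Valid f (inj₂ (lo , hi))
  empty-bracket-violation {a = a} B = lo⪯hi B , λ flo⪯fhi →
    <⇒≱ (subst (_ <_) (+-identityʳ a) (f-hi₀<a+s B)) (≤-trans (a≤f-lo₀ B) (flo⪯fhi zero))

  module _ {F a t lo hi} (B : Bracket f (suc F) a (suc t) lo hi) where

    ⌈t/2⌉<2^F : ⌈ t /2⌉ < 2 ^ F
    ⌈t/2⌉<2^F = n<2*m⇒⌊n/2⌋<m (suc t) (s<2^rounds B)

    toℕ-midpoint : toℕ (midpoint a t lo hi) ≡ a + ⌈ t /2⌉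
    toℕ-midpoint = toℕ-clamp-id (lo zero) (hi zero) (≤-trans (lo₀≤a B) (m≤m+n a _))
      (s≤s⁻¹ (≤-trans (+-monoʳ-< a (s≤s (⌈n/2⌉≤n t))) (a+s≤1+hi₀ B)))

    lo₀≤midpoint : toℕ (lo zero) ≤ toℕ (midpoint a t lo hi)
    lo₀≤midpoint = clamp-≥ (lo zero) (hi zero) _ (lo⪯hi B zero)

    midpoint≤hi₀ : toℕ (midpoint a t lo hi) ≤ toℕ (hi zero)
    midpoint≤hi₀ = clamp-≤ (lo zero) (hi zero) _

    module _ {p} (p₀≡mid : toℕ (p zero) ≡ a + ⌈ t /2⌉) (tail-fixed : tail (f p) ≐ tail p) where

      lower-half : lo ⪯ p → toℕ (f p zero) < toℕ (p zero) → Bracket f F a ⌈ t /2⌉ lo p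
      lower-half lo⪯p fp₀<p₀ = record
        { lo⪯hi      = lo⪯p
        ; lo⪯f-lo    = lo⪯f-lo B
        ; f-hi⪯hi    = λ { zero    → <⇒≤ fp₀<p₀
                         ; (suc i) → ≤-reflexive (cong toℕ (tail-fixed i)) }
        ; lo₀≤a      = lo₀≤a B
        ; a≤f-lo₀    = a≤f-lo₀ B
        ; a+s≤1+hi₀  = subst (_≤ suc (toℕ (p zero))) p₀≡mid (n≤1+n _)
        ; f-hi₀<a+s  = subst (toℕ (f p zero) <_) p₀≡mid fp₀<p₀
        ; s<2^rounds = ⌈t/2⌉<2^F
        }

      upper-half : p ⪯ hi → toℕ (p zero) < toℕ (f p zero) →
                   Bracket f F (suc (toℕ (p zero))) ⌊ t /2⌋ p hi
      upper-half p⪯hi p₀<fp₀ = record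
        { lo⪯hi      = p⪯hi
        ; lo⪯f-lo    = λ { zero    → <⇒≤ p₀<fp₀
                         ; (suc i) → ≤-reflexive (cong toℕ (sym (tail-fixed i))) }
        ; f-hi⪯hi    = f-hi⪯hi B
        ; lo₀≤a      = n≤1+n _
        ; a≤f-lo₀    = p₀<fp₀
        ; a+s≤1+hi₀  = subst (_≤ suc (toℕ (hi zero))) (sym same-end) (a+s≤1+hi₀ B)
        ; f-hi₀<a+s  = subst (toℕ (f hi zero) <_) (sym same-end) (f-hi₀<a+s B)
        ; s<2^rounds = ≤-<-trans (⌊n/2⌋≤⌈n/2⌉ t) ⌈t/2⌉<2^F
        }
        where
          same-end : suc (toℕ (p zero)) + ⌊ t /2⌋ ≡ a + suc t
          same-end = begin
            suc (toℕ (p zero)) + ⌊ t /2⌋   ≡⟨ cong (λ m → suc m + ⌊ t /2⌋) p₀≡mid ⟩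
            suc (a + ⌈ t /2⌉ + ⌊ t /2⌋)    ≡⟨ cong suc (+-assoc a ⌈ t /2⌉ ⌊ t /2⌋) ⟩
            suc (a + (⌈ t /2⌉ + ⌊ t /2⌋))  ≡⟨ cong (λ m → suc (a + m)) (+-comm ⌈ t /2⌉ ⌊ t /2⌋) ⟩
            suc (a + (⌊ t /2⌋ + ⌈ t /2⌉))  ≡⟨ cong (λ m → suc (a + m)) (⌊n/2⌋+⌈n/2⌉≡n t) ⟩
            suc (a + t)                    ≡⟨ +-suc a t ⟨
            a + suc t                      ∎
            where open ≡-Reasoning

module BinarySearch {k} {ns : Fin (suc k) → ℕ} (A : Alg k (ns ∘ suc)) where

  mutual
    search : (rounds a s : ℕ) (lo hi : Point (suc k) ns) → Alg (suc k) ns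
    search zero    a s       lo hi = output (inj₂ (lo , hi))
    search (suc F) a zero    lo hi = output (inj₂ (lo , hi))
    search (suc F) a (suc t) lo hi =
      simulate (midpoint a t lo hi ∷_) (tail ∘ clampPoint lo hi) A (onSliceAnswer F a t lo hi)

    onSliceAnswer : (F a t : ℕ) (lo hi : Point (suc k) ns) → Answer k (ns ∘ suc) → Alg (suc k) ns
    onSliceAnswer F a t lo hi (inj₂ (x , y)) = output (inj₂ (m ∷ x , m ∷ y))
      where m = midpoint a t lo hi
    onSliceAnswer F a t lo hi (inj₁ x) = query p λ fp →
      afterQuery F a t lo hi p fp (lo ⪯? fp) (fp ⪯? hi) (<-cmp (toℕ (fp zero)) (toℕ (p zero)))
      where p = midpoint a t lo hi ∷ x

    afterQuery : (F a t : ℕ) (lo hi p fp : Point (suc k) ns) → Dec (lo ⪯ fp) → Dec (fp ⪯ hi) →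
                 Tri (toℕ (fp zero) < toℕ (p zero)) (toℕ (fp zero) ≡ toℕ (p zero))
                     (toℕ (p zero) < toℕ (fp zero)) →
                 Alg (suc k) ns
    afterQuery F a t lo hi p fp (no _)  _      _            = output (inj₂ (lo , p))
    afterQuery F a t lo hi p fp (yes _) (no _) _            = output (inj₂ (p , hi))
    afterQuery F a t lo hi p fp (yes _) (yes _) (tri< _ _ _) = search F a ⌈ t /2⌉ lo p
    afterQuery F a t lo hi p fp (yes _) (yes _) (tri≈ _ _ _) = output (inj₁ p)
    afterQuery F a t lo hi p fp (yes _) (yes _) (tri> _ _ _) =
      search F (suc (toℕ (p zero))) ⌊ t /2⌋ p hi

  module Correctness {q} (A-solves : ∀ g → SolvesWithin A g q) (f : Point (suc k) ns → Point (suc k) ns)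
    where
    open Bracket

    mutual
      search-solves : ∀ F a s lo hi → Bracket f F a s lo hi →
                      SolvesWithin (search F a s lo hi) f (F * suc q)
      search-solves zero    a zero    lo hi B = z≤n , empty-bracket-violation B
      search-solves zero    a (suc t) lo hi B = contradiction (s<2^rounds B) λ { (s≤s ()) }
      search-solves (suc F) a zero    lo hi B = z≤n , empty-bracket-violation B
      search-solves (suc F) a (suc t) lo hi B =
        subst (_≤ suc F * suc q) (sym (cost-simulate ι π f A κ))
          (≤-trans (+-mono-≤ (proj₁ (A-solves g)) (proj₁ rest))
                   (≤-reflexive (+-suc q (F * suc q)))) ,
        subst (Valid f) (sym (run-simulate ι π f A κ)) (proj₂ rest)
        where
          ι = midpoint a t lo hi ∷_
          π = tail ∘ clampPoint lo hi
          κ = onSliceAnswer F a t lo hi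
          g = slice f lo hi (midpoint a t lo hi)
          rest = onSliceAnswer-solves F a t lo hi B (run A g) (proj₂ (A-solves g))

      onSliceAnswer-solves : ∀ F a t lo hi → Bracket f (suc F) a (suc t) lo hi →
        ∀ ans → Valid (slice f lo hi (midpoint a t lo hi)) ans →
        SolvesWithin (onSliceAnswer F a t lo hi ans) f (suc (F * suc q))
      onSliceAnswer-solves F a t lo hi B (inj₂ _) violation =
        z≤n , slice-violation f lo hi _ violation
      onSliceAnswer-solves F a t lo hi B (inj₁ x) fixed =
        map₁ s≤s (afterQuery-solves F a t lo hi B x fixed
                    (lo ⪯? f p) (f p ⪯? hi) (<-cmp (toℕ (f p zero)) (toℕ (p zero))))
        where p = midpoint a t lo hi ∷ x

      afterQuery-solves : ∀ F a t lo hi → Bracket f (suc F) a (suc t) lo hi →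
        ∀ x → Valid (slice f lo hi (midpoint a t lo hi)) (inj₁ x) →
        let p = midpoint a t lo hi ∷ x in
        ∀ lo?fp fp?hi cmp →
        SolvesWithin (afterQuery F a t lo hi p (f p) lo?fp fp?hi cmp) f (F * suc q)
      afterQuery-solves F a t lo hi B x fixed = cases
        where
          p = midpoint a t lo hi ∷ x
          lo⪯p : lo ⪯ p
          lo⪯p = slice-fixed-point-≥ f lo hi _ fixed (lo⪯hi B) (lo₀≤midpoint B)
          p⪯hi : p ⪯ hi
          p⪯hi = slice-fixed-point-≤ f lo hi _ fixed (midpoint≤hi₀ B)
          cases : ∀ lo?fp fp?hi cmp →
                  SolvesWithin (afterQuery F a t lo hi p (f p) lo?fp fp?hi cmp) f (F * suc q)
          cases (no lo⋠fp)  _            _ = z≤n , lower-violation f (lo⪯f-lo B) lo⪯p lo⋠fp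
          cases (yes _)     (no fp⋠hi)   _ = z≤n , upper-violation f (f-hi⪯hi B) p⪯hi fp⋠hi
          cases (yes lo⪯fp) (yes fp⪯hi) = compare-first
            where
              tail-fixed : tail (f p) ≐ x
              tail-fixed = slice-fixed-point-tail f lo hi _ fixed lo⪯fp fp⪯hi
              compare-first : ∀ cmp →
                SolvesWithin (afterQuery F a t lo hi p (f p) (yes lo⪯fp) (yes fp⪯hi) cmp) f (F * suc q)
              compare-first (tri< fp₀<p₀ _ _) =
                search-solves F a ⌈ t /2⌉ lo p (lower-half B (toℕ-midpoint B) tail-fixed lo⪯p fp₀<p₀)
              compare-first (tri≈ _ fp₀≡p₀ _) =
                z≤n , λ { zero → toℕ-injective fp₀≡p₀ ; (suc i) → tail-fixed i }
              compare-first (tri> _ _ p₀<fp₀) =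
                search-solves F (suc (toℕ (p zero))) ⌊ t /2⌋ p hi
                  (upper-half B (toℕ-midpoint B) tail-fixed p⪯hi p₀<fp₀)

initial-bracket : ∀ {k} {ns : Fin (suc k) → ℕ} (pos : ∀ i → 1 ≤ ns i)
                  (f : Point (suc k) ns → Point (suc k) ns) →
                  ∀ {F} → ns zero < 2 ^ F → Bracket f F 0 (ns zero) (bottom pos) (top pos)
initial-bracket pos f ns₀<2^F = record
  { lo⪯hi      = λ i → least-≤ (pos i) _
  ; lo⪯f-lo    = λ i → least-≤ (pos i) _
  ; f-hi⪯hi    = λ i → ≤-greatest (pos i) _
  ; lo₀≤a      = ≤-reflexive (toℕ-least (pos zero))
  ; a≤f-lo₀    = z≤n
  ; a+s≤1+hi₀  = ≤-reflexive (sym (suc-toℕ-greatest (pos zero)))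
  ; f-hi₀<a+s  = toℕ<n _
  ; s<2^rounds = ns₀<2^F
  }

lemma16 : (k n q : ℕ)
    → ((ns : Fin k → ℕ) → SizesBounded k ns n → SolvableWith k ns q)
    → (ns : Fin (suc k) → ℕ) → SizesBounded (suc k) ns n
    → Σ ℕ (λ c → WithinBound n q c × SolvableWith (suc k) ns c)
lemma16 k n q solve ns sizes with floor-log₂ n (≤-trans (proj₁ (sizes zero)) (proj₂ (sizes zero)))
... | e , 2^e≤n , n<2^e+1 =
  suc e * suc q , withinBound q e 2^e≤n ,
  search (suc e) 0 (ns zero) (bottom pos) (top pos) , λ f →
    Correctness.search-solves (proj₂ slice-solver) f (suc e) 0 (ns zero) _ _
      (initial-bracket pos f (≤-<-trans (proj₂ (sizes zero)) n<2^e+1))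
  where
    pos : ∀ i → 1 ≤ ns i
    pos = proj₁ ∘ sizes
    slice-solver : SolvableWith k (ns ∘ suc) q
    slice-solver = solve (ns ∘ suc) (sizes ∘ suc)
    open BinarySearch {ns = ns} (proj₁ slice-solver)
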